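{- Let $\pi_\lambda$ be the Lebesgue transition function on the Farey tree and $\mathbf J$ the jimm involution, both as defined in the context. Then for every $r\in\mathbb{Q}\cap(0,1)$, $$\pi_\lambda(\mathbf J(r))=\mathbf J(\pi_\lambda(r)).$$
   Context: Continued fractions: $[0,a_1,\dots,a_m]=1/(a_1+1/(\cdots+1/a_m))$, with $[0]=0$. Every $r\in\mathbb{Q}\cap(0,1)$ has a unique expansion $r=[0,n_1,\dots,n_k]$ with positive $n_i$ and $n_k\ge2$. Farey tree: the vertex set is $\mathbb{Q}\cap(0,1)$ with root $1/2$. For $r=[0,n_1,\dots,n_k]\neq1/2$ ($n_k\ge2$), its parent is $[0,n_1,\dots,n_{k-1},n_k-1]$, with $[0,\dots,a,1]=[0,\dots,a+1]$. The Farey interval $I(r)$ is the closed interval with endpoints $[0,n_1,\dots,n_{k-1}]$ and $[0,n_1,\dots,n_{k-1},n_k-1]$; for example $I(1/2)=[0,1]$. The Lebesgue transition function is defined by $\pi_\lambda(1/2)=1$ and $\pi_\lambda(r)=|I(r)|/|I(\mathrm{parent}(r))|$ for $r\neq1/2$. These are the left/right turning probabilities of a non-backtracking random walk down the Farey tree whose induced measure on $[0,1]$ is Lebesgue measure. Thus $\pi_\lambda(r)\in\mathbb{Q}\cap(0,1)$ for $r\ne1/2$. Jimm: write $1_m$ for a block of $m$ ones. For $r=[0,n_1,\dots,n_k]$ with $n_k\ge2$ and $k\ge2$, first form $$[0,1_{n_1-1},2,1_{n_2-2},2,\dots,1_{n_{k-1}-2},2,1_{n_k-1}].$$ Then reduce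 it, one rule at a time, until all entries are $\ge1$: - a block $1_0$ is deleted; - a block $1_{ -1}$ between entries $m,n$ is replaced by the single entry $m+n-1$. The result is $\mathbf J(r)$. For $k=1$, $\mathbf J([0,n_1])=[0,1_{n_1-1}]$. For example, $\mathbf J(1/2)=1/2$, $\mathbf J(1/3)=2/3$ and $\mathbf J(2/3)=1/3$. In addition set $\mathbf J(1)=1$, consistent with the extension $\mathbf J(1/x)=1/\mathbf J(x)$; this covers the value $\pi_\lambda(1/2)=1$. $\mathbf J$ is an involution of $\mathbb{Q}\cap(0,1)$ that maps siblings in the Farey tree to siblings and fixes the root. -}

module Defs where

open import Data.Bool using (Bool; true; false)
open import Data.Nat as ℕ using (ℕ; zero; suc; _∸_)
open import Data.Nat.DivMod using (_/_; _%_)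
open import Data.Integer as ℤ using (ℤ; +_; -[1+_]; _⊖_)
open import Data.List using (List; []; _∷_; _++_; [_]; replicate; reverse)
open import Data.Rational as ℚ
  using (ℚ; 0ℚ; 1ℚ; ½; ↥_; ↧ₙ_; _-_; ∣_∣; _÷_; ≢-nonZero)
open import Data.Rational.Properties using (_≟_)
open import Relation.Nullary using (yes; no)

-- Total auxiliary operations on ℚ (junk value 0 on division by zero;
-- never triggered on the inputs relevant to the theorem).

recipℚ : ℚ → ℚ
recipℚ p with p ≟ 0ℚ
... | yes _ = 0ℚ
... | no p≢0 = _÷_ 1ℚ p {{≢-nonZero p≢0}}

_÷ℚ_ : ℚ → ℚ → ℚ
p ÷ℚ q with q ≟ 0ℚ
... | yes _ = 0ℚ
... | no q≢0 = _÷_ p q {{≢-nonZero q≢0}}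

-- Continued fractions: cf (a₁ ∷ … ∷ aₘ ∷ []) = [0,a₁,…,aₘ], cf [] = [0] = 0.

cf : List ℕ → ℚ
cf []       = 0ℚ
cf (a ∷ as) = recipℚ ((+ a ℚ./ 1) ℚ.+ cf as)

-- Euclidean algorithm: the expansion [n₁,…,n_k] (n_k ≥ 2) of p/q for
-- 0 < p < q, with explicit fuel (fuel ≥ p suffices).
cfExpand : ℕ → ℕ → ℕ → List ℕ
cfExpand zero     _       _ = []
cfExpand (suc f)  zero    _ = []
cfExpand (suc f) (suc p)  q with q % suc p
... | zero  = [ q / suc p ]
... | suc s = (q / suc p) ∷ cfExpand f (suc s) (suc p)

-- The unique expansion r = [0,n₁,…,n_k], n_k ≥ 2, of r ∈ ℚ ∩ (0,1).
expansion : ℚ → List ℕ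
expansion r = cfExpand (ℤ.∣ ↥ r ∣) (ℤ.∣ ↥ r ∣) (↧ₙ r)

data Split : Set where
  none : Split
  split : List ℕ → ℕ → Split

splitLast : List ℕ → Split
splitLast []       = none
splitLast (x ∷ xs) with splitLast xs
... | none        = split [] x
... | split ys y  = split (x ∷ ys) y

parent : ℚ → ℚ
parent r with splitLast (expansion r)
... | none       = 0ℚ
... | split ns n = cf (ns ++ [ n ∸ 1 ])

-- |I(r)| : length of the interval with endpoints
-- [0,n₁,…,n_{k-1}] and [0,n₁,…,n_{k-1},n_k - 1].
fareyLength : ℚ → ℚ
fareyLength r with splitLast (expansion r)
... | none       = 0ℚ
... | split ns n = ∣ cf ns - cf (ns ++ [ n ∸ 1 ]) ∣

πλ : ℚ → ℚ
πλ r with r ≟ ½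
... | yes _ = 1ℚ
... | no  _ = fareyLength r ÷ℚ fareyLength (parent r)

-- formal entries: a block 1_m of m ones (m ≥ -1, as an integer) or an entry.
data Tok : Set where
  blk : ℤ → Tok
  ent : ℕ → Tok

-- middle part for n₂,…,n_k:  1_{n₂-2},2,…,1_{n_{k-1}-2},2,1_{n_k-1}
jimmMid : List ℕ → List Tok
jimmMid []           = []
jimmMid (n ∷ [])     = blk (n ⊖ 1) ∷ []
jimmMid (n ∷ m ∷ ns) = blk (n ⊖ 2) ∷ ent 2 ∷ jimmMid (m ∷ ns)

-- the formal sequence [0,1_{n₁-1},2,1_{n₂-2},2,…,2,1_{n_k-1}]  (k ≥ 2)
jimmTokens : List ℕ → List Tok
jimmTokens []           = []
jimmTokens (n ∷ [])     = []
jimmTokens (n ∷ m ∷ ns) = blk (n ⊖ 1) ∷ ent 2 ∷ jimmMid (m ∷ ns)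

-- reduction, left to right: 1_m (m ≥ 0) becomes m ones (1_0 is deleted);
-- a block 1_{-1} between entries m,n is replaced by m + n - 1.
-- acc: output so far (reversed); the Bool records a pending 1_{-1}.
reduce : List ℕ → Bool → List Tok → List ℕ
reduce acc p []                         = reverse acc
reduce acc p (blk (+ m) ∷ ts)           = reduce (replicate m 1 ++ acc) p ts
reduce acc p (blk -[1+ _ ] ∷ ts)        = reduce acc true ts
reduce (m ∷ acc) true (ent n ∷ ts)      = reduce ((m ℕ.+ n ∸ 1) ∷ acc) false ts
reduce []        true (ent n ∷ ts)      = reduce (n ∷ []) false ts
reduce acc       false (ent n ∷ ts)     = reduce (n ∷ acc) false ts

jimmList : List ℕ → List ℕ
jimmList []           = []
jimmList (n ∷ [])     = replicate n 1
jimmList (n ∷ m ∷ ns) = reduce [] false (jimmTokens (n ∷ m ∷ ns))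

J : ℚ → ℚ
J r with r ≟ 1ℚ
... | yes _ = 1ℚ
... | no  _ = cf (jimmList (expansion r))

module Submission where

-- Every rational in (0, 1) is reached from ½ = [0, 2] in the Farey tree by a path of two kinds of
-- moves: raise the last partial quotient, or lower it by one and append a new last entry 2; jimm just
-- exchanges the two kinds of moves. If the endpoints of the Farey interval of a vertex have denominators
-- q and q′, the interval has length 1 / (q q′), and one more move replaces (q, q′) by (q, q + q′) or by
-- (q′, q + q′). So π_λ of the vertex at the end of a path w x is q q′ over the product of the new pair.
-- Run from the other end, the same recursion computes numerators and denominators: for w = y u, q / q′
-- is the vertex at the end of reverse u, and π_λ of the vertex at y u x is the vertex at x̄ (reverse u),
-- where x̄ is the other kind of move. Both operations on paths commute with exchanging the moves.

open import Defs
open import Data.Rational using (ℚ; 0ℚ; 1ℚ; _<_)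
open import Relation.Binary.PropositionalEquality using (_≡_)

open import Data.Bool using (false)
open import Data.Empty using (⊥-elim)
open import Data.Integer as ℤ using (+_; -[1+_])
import Data.Integer.Properties as ℤ
open import Data.List using (List; []; _∷_; _++_; [_]; _∷ʳ_; foldr; foldl; replicate; reverse; map)
import Data.List.Properties as List
open import Data.List.Relation.Unary.All using (All; []; _∷_)
import Data.List.Relation.Unary.All.Properties as All
open import Data.List.Reverse using (reverseView; []; _∶_∶ʳ_)
open import Data.Nat as ℕ using (ℕ; zero; suc; _∸_; NonZero; z≤n; s≤s)
open import Data.Nat.Coprimality using (Coprime; recompute; 0-coprimeTo-m⇒m≡1)
open import Data.Nat.Divisibility
  using (_∣_; ∣-refl; ∣1⇒≡1; ∣m+n∣m⇒∣n; ∣n⇒∣m*n; ∣m∣n⇒∣m+n; m%n≡0⇒n∣m)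
open import Data.Nat.DivMod
  using ( _%_; _/_; [m+kn]%n≡m%n; m<n⇒m%n≡m; +-distrib-/; m*n/n≡m; m<n⇒m/n≡0; m*n%n≡0
        ; n/1≡n; n%1≡0; m%n<n; m≡m%n+[m/n]*n; m≥n⇒m/n>0)
import Data.Nat.Properties as ℕ
open import Data.Nat.Tactic.RingSolver using (solve-∀)
open import Data.Product using (_×_; _,_; proj₁; proj₂; ∃; ∃₂; uncurry)
open import Data.Rational as ℚ using (mkℚ; ½; _+_; _*_; _-_; -_; ∣_∣; 1/_; toℚᵘ; ≢-nonZero)
import Data.Rational.Properties as ℚ
open import Algebra.Properties.AbelianGroup ℚ.+-0-abelianGroup using (xyx⁻¹≈y; ⁻¹-anti-homo‿-)
open import Data.Rational.Unnormalised.Base as ℚᵘ using (mkℚᵘ; *≡*)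
  renaming (_≃_ to _≃ᵘ_; _/_ to _/ᵘ_)
import Data.Rational.Unnormalised.Properties as ℚᵘ
open import Data.Sum using (_⊎_; inj₁; inj₂)
open import Function using (_∘_; flip)
open import Relation.Binary.PropositionalEquality
  using (refl; sym; trans; cong; cong₂; subst; subst₂; _≢_; module ≡-Reasoning)
open import Relation.Nullary using (yes; no)

replicate-suc-++ : ∀ {A : Set} k (x : A) w → replicate (suc k) x ++ w ≡ replicate k x ++ x ∷ w
replicate-suc-++ zero    x w = refl
replicate-suc-++ (suc k) x w = cong (x ∷_) (replicate-suc-++ k x w)

reverse-replicate : ∀ {A : Set} k (x : A) → reverse (replicate k x) ≡ replicate k x
reverse-replicate zero    x = refl
reverse-replicate (suc k) x = begin
  reverse (x ∷ replicate k x)   ≡⟨ List.unfold-reverse x (replicate k x) ⟩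
  reverse (replicate k x) ∷ʳ x  ≡⟨ cong (_∷ʳ x) (reverse-replicate k x) ⟩
  replicate k x ++ [ x ]        ≡⟨ replicate-suc-++ k x [] ⟨
  replicate (suc k) x ++ []     ≡⟨ List.++-identityʳ (replicate (suc k) x) ⟩
  replicate (suc k) x           ∎
  where open ≡-Reasoning

reverse-replicate-++ : ∀ {A : Set} k (x c : A) xs →
                       reverse (replicate k x ++ c ∷ xs) ≡ reverse xs ++ c ∷ replicate k x
reverse-replicate-++ k x c xs = begin
  reverse (replicate k x ++ c ∷ xs)
    ≡⟨ List.reverse-++ (replicate k x) (c ∷ xs) ⟩
  reverse (c ∷ xs) ++ reverse (replicate k x)
    ≡⟨ cong₂ _++_ (List.unfold-reverse c xs) (reverse-replicate k x) ⟩
  (reverse xs ∷ʳ c) ++ replicate k x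
    ≡⟨ List.++-assoc (reverse xs) [ c ] (replicate k x) ⟩
  reverse xs ++ c ∷ replicate k x ∎
  where open ≡-Reasoning

foldl-fusion : ∀ {A B C : Set} (h : B → C) {f : B → A → B} {g : C → A → C} (e : B) →
               (∀ b a → h (f b a) ≡ g (h b) a) → ∀ xs → h (foldl f e xs) ≡ foldl g (h e) xs
foldl-fusion h e fuse []               = refl
foldl-fusion h {f} {g} e fuse (x ∷ xs) =
  trans (foldl-fusion h (f e x) fuse xs) (cong (λ c → foldl g c xs) (fuse e x))

frac : ℕ → ℕ → ℚ
frac a zero    = 0ℚ
frac a (suc b) = + a ℚ./ suc b

toℚᵘ-frac : ∀ a b .{{_ : NonZero b}} → toℚᵘ (frac a b) ≃ᵘ + a /ᵘ b
toℚᵘ-frac a (suc b) = ℚ.toℚᵘ-fromℚᵘ (mkℚᵘ (+ a) b)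

frac-≡ : ∀ a b c d .{{_ : NonZero b}} .{{_ : NonZero d}} →
         a ℕ.* d ≡ c ℕ.* b → frac a b ≡ frac c d
frac-≡ a b@(suc _) c d@(suc _) ad≡cb = ℚ.toℚᵘ-injective (begin
  toℚᵘ (frac a b)  ≈⟨ toℚᵘ-frac a b ⟩
  + a /ᵘ b         ≈⟨ *≡* cross ⟩
  + c /ᵘ d         ≈⟨ toℚᵘ-frac c d ⟨
  toℚᵘ (frac c d)  ∎)
  where
  open ℚᵘ.≃-Reasoning
  cross : + a ℤ.* + d ≡ + c ℤ.* + b
  cross = trans (sym (ℤ.pos-* a d)) (trans (cong +_ ad≡cb) (ℤ.pos-* c b))

frac-+ : ∀ a b c d .{{_ : NonZero b}} .{{_ : NonZero d}} →
         frac a b + frac c d ≡ frac (a ℕ.* d ℕ.+ c ℕ.* b) (b ℕ.* d)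
frac-+ a b@(suc _) c d@(suc _) = ℚ.toℚᵘ-injective (begin
  toℚᵘ (frac a b + frac c d)            ≈⟨ ℚ.toℚᵘ-homo-+ (frac a b) (frac c d) ⟩
  toℚᵘ (frac a b) ℚᵘ.+ toℚᵘ (frac c d)  ≈⟨ ℚᵘ.+-cong (toℚᵘ-frac a b) (toℚᵘ-frac c d) ⟩
  + a /ᵘ b ℚᵘ.+ + c /ᵘ d                ≡⟨ cong (_/ᵘ (b ℕ.* d)) numerator ⟩
  + (a ℕ.* d ℕ.+ c ℕ.* b) /ᵘ (b ℕ.* d)  ≈⟨ toℚᵘ-frac _ (b ℕ.* d) ⟨
  toℚᵘ (frac (a ℕ.* d ℕ.+ c ℕ.* b) (b ℕ.* d)) ∎)
  where
  open ℚᵘ.≃-Reasoning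
  numerator : + a ℤ.* + d ℤ.+ + c ℤ.* + b ≡ + (a ℕ.* d ℕ.+ c ℕ.* b)
  numerator = trans (cong₂ ℤ._+_ (sym (ℤ.pos-* a d)) (sym (ℤ.pos-* c b)))
                    (sym (ℤ.pos-+ (a ℕ.* d) (c ℕ.* b)))

frac-* : ∀ a b c d .{{_ : NonZero b}} .{{_ : NonZero d}} →
         frac a b * frac c d ≡ frac (a ℕ.* c) (b ℕ.* d)
frac-* a b@(suc _) c d@(suc _) = ℚ.toℚᵘ-injective (begin
  toℚᵘ (frac a b * frac c d)            ≈⟨ ℚ.toℚᵘ-homo-* (frac a b) (frac c d) ⟩
  toℚᵘ (frac a b) ℚᵘ.* toℚᵘ (frac c d)  ≈⟨ ℚᵘ.*-cong (toℚᵘ-frac a b) (toℚᵘ-frac c d) ⟩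
  (+ a /ᵘ b) ℚᵘ.* (+ c /ᵘ d)            ≡⟨ cong (_/ᵘ (b ℕ.* d)) (sym (ℤ.pos-* a c)) ⟩
  + (a ℕ.* c) /ᵘ (b ℕ.* d)              ≈⟨ toℚᵘ-frac _ (b ℕ.* d) ⟨
  toℚᵘ (frac (a ℕ.* c) (b ℕ.* d))       ∎)
  where open ℚᵘ.≃-Reasoning

frac-*-swap : ∀ a b .{{_ : NonZero a}} .{{_ : NonZero b}} → frac a b * frac b a ≡ 1ℚ
frac-*-swap a@(suc _) b@(suc _) = trans (frac-* a b b a) (frac-≡ (a ℕ.* b) (b ℕ.* a) 1 1 (cross a b))
  where
  cross : ∀ a b → a ℕ.* b ℕ.* 1 ≡ 1 ℕ.* (b ℕ.* a)
  cross = solve-∀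

∣frac∣ : ∀ a b → ∣ frac a b ∣ ≡ frac a b
∣frac∣ a zero    = refl
∣frac∣ a (suc b) = ℚ.0≤p⇒∣p∣≡p (ℚ.nonNegative⁻¹ _ {{ℚ.normalize-nonNeg a (suc b)}})

1/-unique : ∀ x y .{{_ : ℚ.NonZero x}} → x * y ≡ 1ℚ → 1/ x ≡ y
1/-unique x y xy≡1 = begin
  1/ x             ≡⟨ ℚ.*-identityʳ (1/ x) ⟨
  1/ x * 1ℚ        ≡⟨ cong (1/ x *_) xy≡1 ⟨
  1/ x * (x * y)   ≡⟨ ℚ.*-assoc (1/ x) x y ⟨
  (1/ x * x) * y   ≡⟨ cong (_* y) (ℚ.*-inverseˡ x) ⟩
  1ℚ * y           ≡⟨ ℚ.*-identityˡ y ⟩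
  y                ∎
  where open ≡-Reasoning

-- x * y ≡ 1ℚ rules out x = 0ℚ, where recipℚ and ÷ℚ return the junk value 0ℚ.
recipℚ-unique : ∀ x y → x * y ≡ 1ℚ → recipℚ x ≡ y
recipℚ-unique x y xy≡1 with x ℚ.≟ 0ℚ
... | yes refl with () ← trans (sym (ℚ.*-zeroˡ y)) xy≡1
... | no x≢0   = trans (ℚ.*-identityˡ _) (1/-unique x y {{≢-nonZero x≢0}} xy≡1)

÷ℚ-unique : ∀ p x y → x * y ≡ 1ℚ → p ÷ℚ x ≡ p * y
÷ℚ-unique p x y xy≡1 with x ℚ.≟ 0ℚ
... | yes refl with () ← trans (sym (ℚ.*-zeroˡ y)) xy≡1
... | no x≢0   = cong (p *_) (1/-unique x y {{≢-nonZero x≢0}} xy≡1)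

frac-÷ℚ : ∀ a b .{{_ : NonZero a}} .{{_ : NonZero b}} → frac 1 a ÷ℚ frac 1 b ≡ frac b a
frac-÷ℚ a@(suc _) b@(suc _) = begin
  frac 1 a ÷ℚ frac 1 b      ≡⟨ ÷ℚ-unique (frac 1 a) (frac 1 b) (frac b 1) (frac-*-swap 1 b) ⟩
  frac 1 a * frac b 1       ≡⟨ frac-* 1 a b 1 ⟩
  frac (1 ℕ.* b) (a ℕ.* 1)  ≡⟨ cong₂ frac (ℕ.*-identityˡ b) (ℕ.*-identityʳ a) ⟩
  frac b a                  ∎
  where open ≡-Reasoning

FareyNeighbours : ℕ → ℕ → ℕ → ℕ → Set
FareyNeighbours a b c d = a ℕ.* d ≡ c ℕ.* b ℕ.+ 1 ⊎ c ℕ.* b ≡ a ℕ.* d ℕ.+ 1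

frac-split : ∀ a b c d .{{_ : NonZero b}} .{{_ : NonZero d}} →
             a ℕ.* d ≡ c ℕ.* b ℕ.+ 1 → frac a b ≡ frac c d + frac 1 (b ℕ.* d)
frac-split a b@(suc _) c d@(suc _) ad≡cb+1 = sym (begin
  frac c d + frac 1 (b ℕ.* d)  ≡⟨ frac-+ c d 1 (b ℕ.* d) ⟩
  frac n (d ℕ.* (b ℕ.* d))     ≡⟨ frac-≡ n (d ℕ.* (b ℕ.* d)) a b cross ⟩
  frac a b                     ∎)
  where
  open ≡-Reasoning
  n : ℕ
  n = c ℕ.* (b ℕ.* d) ℕ.+ 1 ℕ.* d
  regroup : ∀ c b d → (c ℕ.* (b ℕ.* d) ℕ.+ 1 ℕ.* d) ℕ.* b ≡ (c ℕ.* b ℕ.+ 1) ℕ.* (d ℕ.* b)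
  regroup = solve-∀
  regroup′ : ∀ a b d → a ℕ.* d ℕ.* (d ℕ.* b) ≡ a ℕ.* (d ℕ.* (b ℕ.* d))
  regroup′ = solve-∀
  cross : n ℕ.* b ≡ a ℕ.* (d ℕ.* (b ℕ.* d))
  cross = begin
    n ℕ.* b                             ≡⟨ regroup c b d ⟩
    (c ℕ.* b ℕ.+ 1) ℕ.* (d ℕ.* b)       ≡⟨ cong (ℕ._* (d ℕ.* b)) ad≡cb+1 ⟨
    a ℕ.* d ℕ.* (d ℕ.* b)               ≡⟨ regroup′ a b d ⟩
    a ℕ.* (d ℕ.* (b ℕ.* d))             ∎

∣frac-frac∣ : ∀ a b c d .{{_ : NonZero b}} .{{_ : NonZero d}} →
              FareyNeighbours a b c d → ∣ frac a b - frac c d ∣ ≡ frac 1 (b ℕ.* d)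
∣frac-frac∣ a b@(suc _) c d@(suc _) (inj₁ ad≡cb+1) = begin
  ∣ frac a b - frac c d ∣         ≡⟨ cong (λ x → ∣ x - frac c d ∣) (frac-split a b c d ad≡cb+1) ⟩
  ∣ frac c d + e - frac c d ∣     ≡⟨ cong ∣_∣ (xyx⁻¹≈y (frac c d) e) ⟩
  ∣ e ∣                           ≡⟨ ∣frac∣ 1 (b ℕ.* d) ⟩
  e                               ∎
  where
  open ≡-Reasoning
  e : ℚ
  e = frac 1 (b ℕ.* d)
∣frac-frac∣ a b@(suc _) c d@(suc _) (inj₂ cb≡ad+1) = begin
  ∣ frac a b - frac c d ∣         ≡⟨ cong (λ x → ∣ frac a b - x ∣) (frac-split c d a b cb≡ad+1) ⟩
  ∣ frac a b - (frac a b + e) ∣   ≡⟨ cong ∣_∣ (⁻¹-anti-homo‿- (frac a b + e) (frac a b)) ⟨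
  ∣ - (frac a b + e - frac a b) ∣ ≡⟨ ℚ.∣-p∣≡∣p∣ _ ⟩
  ∣ frac a b + e - frac a b ∣     ≡⟨ cong ∣_∣ (xyx⁻¹≈y (frac a b) e) ⟩
  ∣ e ∣                           ≡⟨ ∣frac∣ 1 (d ℕ.* b) ⟩
  e                               ≡⟨ cong (frac 1) (ℕ.*-comm d b) ⟩
  frac 1 (b ℕ.* d)                ∎
  where
  open ≡-Reasoning
  e : ℚ
  e = frac 1 (d ℕ.* b)

-- Continuants

mobius : ℕ → ℕ × ℕ → ℕ × ℕ
mobius a (p , q) = q , a ℕ.* q ℕ.+ p

mediant : ℕ × ℕ → ℕ × ℕ → ℕ × ℕ
mediant (p , q) (p′ , q′) = p ℕ.+ p′ , q ℕ.+ q′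

-- cf l = numer l / denom l, obtained by applying the maps p / q ↦ q / (a q + p), a ∈ l, to 0 / 1.
convergent : List ℕ → ℕ × ℕ
convergent = foldr mobius (0 , 1)

numer denom : List ℕ → ℕ
numer l = proj₁ (convergent l)
denom l = proj₂ (convergent l)

denom-nonZero : ∀ {l} → All NonZero l → NonZero (denom l)
denom-nonZero []                  = _
denom-nonZero {a ∷ l} (a≢0 ∷ l≢0) = ℕ.>-nonZero (ℕ.<-≤-trans
  (ℕ.>-nonZero⁻¹ (a ℕ.* denom l) {{ℕ.m*n≢0 a (denom l) {{a≢0}} {{denom-nonZero l≢0}}}})
  (ℕ.m≤m+n (a ℕ.* denom l) (numer l)))

recipℚ-frac-+ : ∀ a n d .{{_ : NonZero a}} .{{_ : NonZero d}} →
                recipℚ (frac a 1 + frac n d) ≡ frac d (a ℕ.* d ℕ.+ n)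
recipℚ-frac-+ a@(suc _) n d@(suc _) = recipℚ-unique (frac a 1 + frac n d) (frac d m) (begin
  (frac a 1 + frac n d) * frac d m  ≡⟨ cong (_* frac d m) sum ⟩
  frac m d * frac d m               ≡⟨ frac-*-swap m d ⟩
  1ℚ                                ∎)
  where
  open ≡-Reasoning
  m : ℕ
  m = a ℕ.* d ℕ.+ n
  cross : ∀ a d n → (a ℕ.* d ℕ.+ n ℕ.* 1) ℕ.* d ≡ (a ℕ.* d ℕ.+ n) ℕ.* (1 ℕ.* d)
  cross = solve-∀
  sum : frac a 1 + frac n d ≡ frac m d
  sum = trans (frac-+ a 1 n d) (frac-≡ (a ℕ.* d ℕ.+ n ℕ.* 1) (1 ℕ.* d) m d (cross a d n))

cf-convergent : ∀ {l} → All NonZero l → cf l ≡ frac (numer l) (denom l)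
cf-convergent []                  = refl
cf-convergent {a ∷ l} (a≢0 ∷ l≢0) = begin
  recipℚ (frac a 1 + cf l)
    ≡⟨ cong (λ x → recipℚ (frac a 1 + x)) (cf-convergent l≢0) ⟩
  recipℚ (frac a 1 + frac (numer l) (denom l))
    ≡⟨ recipℚ-frac-+ a (numer l) (denom l) {{a≢0}} {{denom-nonZero l≢0}} ⟩
  frac (denom l) (a ℕ.* denom l ℕ.+ numer l) ∎
  where open ≡-Reasoning

cf-≡ : ∀ {l m} → All NonZero l → All NonZero m → convergent l ≡ convergent m → cf l ≡ cf m
cf-≡ l≢0 m≢0 eq = trans (cf-convergent l≢0) (trans (cong (uncurry frac) eq) (sym (cf-convergent m≢0)))

numer-denom-coprime : ∀ l → Coprime (numer l) (denom l)
numer-denom-coprime []      (_ , d∣1)      = ∣1⇒≡1 d∣1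
numer-denom-coprime (a ∷ l) (d∣q , d∣aq+p) =
  numer-denom-coprime l (∣m+n∣m⇒∣n d∣aq+p (∣n⇒∣m*n a d∣q) , d∣q)

mediant-comm : ∀ u v → mediant u v ≡ mediant v u
mediant-comm (p , q) (p′ , q′) = cong₂ _,_ (ℕ.+-comm p p′) (ℕ.+-comm q q′)

foldr-mobius-mediant : ∀ l u v →
                       foldr mobius (mediant u v) l ≡ mediant (foldr mobius u l) (foldr mobius v l)
foldr-mobius-mediant []      u v = refl
foldr-mobius-mediant (a ∷ l) u v =
  trans (cong (mobius a) (foldr-mobius-mediant l u v)) (linear a (foldr mobius u l) (foldr mobius v l))
  where
  linear : ∀ a u v → mobius a (mediant u v) ≡ mediant (mobius a u) (mobius a v)
  linear a (p , q) (p′ , q′) = cong (q ℕ.+ q′ ,_) (distrib a p q p′ q′)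
    where
    distrib : ∀ a p q p′ q′ →
              a ℕ.* (q ℕ.+ q′) ℕ.+ (p ℕ.+ p′) ≡ a ℕ.* q ℕ.+ p ℕ.+ (a ℕ.* q′ ℕ.+ p′)
    distrib = solve-∀

convergent-++ : ∀ l m → convergent (l ++ m) ≡ foldr mobius (convergent m) l
convergent-++ l m = List.foldr-++ mobius (0 , 1) l m

convergent-∷ʳ-suc : ∀ l a → convergent (l ∷ʳ suc a) ≡ mediant (convergent (l ∷ʳ a)) (convergent l)
convergent-∷ʳ-suc l a = begin
  convergent (l ∷ʳ suc a)                                       ≡⟨ convergent-++ l [ suc a ] ⟩
  foldr mobius (convergent [ suc a ]) l                         ≡⟨ cong (λ u → foldr mobius u l) seed ⟩
  foldr mobius (mediant (convergent [ a ]) (convergent [])) l   ≡⟨ foldr-mobius-mediant l _ _ ⟩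
  mediant (foldr mobius (convergent [ a ]) l) (convergent l)    ≡⟨ cong (λ u → mediant u (convergent l))
                                                                        (convergent-++ l [ a ]) ⟨
  mediant (convergent (l ∷ʳ a)) (convergent l)                  ∎
  where
  open ≡-Reasoning
  last-entry : ∀ a → suc a ℕ.* 1 ℕ.+ 0 ≡ a ℕ.* 1 ℕ.+ 0 ℕ.+ 1
  last-entry = solve-∀
  seed : convergent [ suc a ] ≡ mediant (convergent [ a ]) (convergent [])
  seed = cong (1 ,_) (last-entry a)

convergent-∷ʳ-∷ʳ1 : ∀ l a →
                     convergent (l ∷ʳ a ∷ʳ 1) ≡ mediant (convergent l) (convergent (l ∷ʳ a))
convergent-∷ʳ-∷ʳ1 l a = begin
  convergent (l ∷ʳ a ∷ʳ 1)
    ≡⟨ cong convergent (List.++-assoc l [ a ] [ 1 ]) ⟩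
  convergent (l ++ a ∷ 1 ∷ [])
    ≡⟨ convergent-++ l (a ∷ 1 ∷ []) ⟩
  foldr mobius (convergent (a ∷ 1 ∷ [])) l
    ≡⟨ cong (λ u → foldr mobius u l) seed ⟩
  foldr mobius (mediant (convergent []) (convergent [ a ])) l
    ≡⟨ foldr-mobius-mediant l _ _ ⟩
  mediant (convergent l) (foldr mobius (convergent [ a ]) l)
    ≡⟨ cong (mediant (convergent l)) (convergent-++ l [ a ]) ⟨
  mediant (convergent l) (convergent (l ∷ʳ a)) ∎
  where
  open ≡-Reasoning
  last-entries : ∀ a → a ℕ.* (1 ℕ.* 1 ℕ.+ 0) ℕ.+ 1 ≡ 1 ℕ.+ (a ℕ.* 1 ℕ.+ 0)
  last-entries = solve-∀
  seed : convergent (a ∷ 1 ∷ []) ≡ mediant (convergent []) (convergent [ a ])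
  seed = cong (1 ,_) (last-entries a)

convergent-∷ʳ1 : ∀ l a → convergent (l ∷ʳ a ∷ʳ 1) ≡ convergent (l ∷ʳ suc a)
convergent-∷ʳ1 l a = trans (convergent-∷ʳ-∷ʳ1 l a)
  (trans (mediant-comm (convergent l) (convergent (l ∷ʳ a))) (sym (convergent-∷ʳ-suc l a)))

neighbours-shift : ∀ b q q′ p p′ → p ℕ.* q′ ≡ p′ ℕ.* q ℕ.+ 1 →
                   q′ ℕ.* (b ℕ.* q ℕ.+ p) ≡ q ℕ.* (b ℕ.* q′ ℕ.+ p′) ℕ.+ 1
neighbours-shift b q q′ p p′ pq′≡p′q+1 = begin
  q′ ℕ.* (b ℕ.* q ℕ.+ p)              ≡⟨ expand b q q′ p ⟩
  b ℕ.* q ℕ.* q′ ℕ.+ p ℕ.* q′          ≡⟨ cong (b ℕ.* q ℕ.* q′ ℕ.+_) pq′≡p′q+1 ⟩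
  b ℕ.* q ℕ.* q′ ℕ.+ (p′ ℕ.* q ℕ.+ 1)  ≡⟨ collect b q q′ p′ ⟩
  q ℕ.* (b ℕ.* q′ ℕ.+ p′) ℕ.+ 1        ∎
  where
  open ≡-Reasoning
  expand : ∀ b q q′ p → q′ ℕ.* (b ℕ.* q ℕ.+ p) ≡ b ℕ.* q ℕ.* q′ ℕ.+ p ℕ.* q′
  expand = solve-∀
  collect : ∀ b q q′ p′ →
            b ℕ.* q ℕ.* q′ ℕ.+ (p′ ℕ.* q ℕ.+ 1) ≡ q ℕ.* (b ℕ.* q′ ℕ.+ p′) ℕ.+ 1
  collect = solve-∀

mobius-neighbours : ∀ b p q p′ q′ → FareyNeighbours p q p′ q′ →
                    FareyNeighbours q (b ℕ.* q ℕ.+ p) q′ (b ℕ.* q′ ℕ.+ p′)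
mobius-neighbours b p q p′ q′ (inj₁ pq′≡p′q+1) = inj₂ (neighbours-shift b q q′ p p′ pq′≡p′q+1)
mobius-neighbours b p q p′ q′ (inj₂ p′q≡pq′+1) = inj₁ (neighbours-shift b q′ q p′ p p′q≡pq′+1)

convergents-neighbours : ∀ l a → FareyNeighbours (numer l) (denom l) (numer (l ∷ʳ a)) (denom (l ∷ʳ a))
convergents-neighbours []      a = inj₂ refl
convergents-neighbours (b ∷ l) a =
  mobius-neighbours b (numer l) (denom l) (numer (l ∷ʳ a)) (denom (l ∷ʳ a)) (convergents-neighbours l a)

consecutive-convergents : ∀ ns a → All NonZero (ns ∷ʳ a) →
                          ∣ cf ns - cf (ns ∷ʳ a) ∣ ≡ frac 1 (denom ns ℕ.* denom (ns ∷ʳ a))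
consecutive-convergents ns a nsa≢0 = begin
  ∣ cf ns - cf (ns ∷ʳ a) ∣
    ≡⟨ cong₂ (λ x y → ∣ x - y ∣) (cf-convergent ns≢0) (cf-convergent nsa≢0) ⟩
  ∣ frac (numer ns) (denom ns) - frac (numer (ns ∷ʳ a)) (denom (ns ∷ʳ a)) ∣
    ≡⟨ ∣frac-frac∣ _ _ _ _ {{denom-nonZero ns≢0}} {{denom-nonZero nsa≢0}} (convergents-neighbours ns a) ⟩
  frac 1 (denom ns ℕ.* denom (ns ∷ʳ a)) ∎
  where
  open ≡-Reasoning
  ns≢0 : All NonZero ns
  ns≢0 = proj₁ (All.∷ʳ⁻ nsa≢0)

-- Canonical expansions and the Euclidean algorithm

data Canonical : List ℕ → Set where
  end : ∀ n → Canonical [ 2 ℕ.+ n ]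
  _∷_ : ∀ a {l} → Canonical l → Canonical (suc a ∷ l)

canonical-[_] : ∀ {q} → 2 ℕ.≤ q → Canonical [ q ]
canonical-[ s≤s (s≤s _) ] = end _

canonical-∷ : ∀ {a l} → 0 ℕ.< a → Canonical l → Canonical (a ∷ l)
canonical-∷ (s≤s z≤n) l = _ ∷ l

Canonical⇒nonZero : ∀ {l} → Canonical l → All NonZero l
Canonical⇒nonZero (end n) = _ ∷ []
Canonical⇒nonZero (a ∷ l) = _ ∷ Canonical⇒nonZero l

Canonical⇒≢[1] : ∀ {l} → Canonical l → l ≢ [ 1 ]
Canonical⇒≢[1] (a ∷ end n)   ()
Canonical⇒≢[1] (a ∷ (b ∷ l)) ()

numer-nonZero : ∀ {l} → Canonical l → NonZero (numer l)
numer-nonZero (end n) = _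
numer-nonZero (a ∷ l) = denom-nonZero (Canonical⇒nonZero l)

numer<denom : ∀ {l} → Canonical l → numer l ℕ.< denom l
numer<denom (end n)               = s≤s (s≤s z≤n)
numer<denom {suc a ∷ l} (a ∷ can) = ℕ.<-≤-trans
  (ℕ.m<m+n (denom l) (ℕ.>-nonZero⁻¹ (numer l) {{numer-nonZero can}}))
  (ℕ.+-monoˡ-≤ (numer l) (ℕ.m≤m+n (denom l) (a ℕ.* denom l)))

[m*n+o]%n≡o : ∀ m n o .{{_ : NonZero n}} → o ℕ.< n → (m ℕ.* n ℕ.+ o) % n ≡ o
[m*n+o]%n≡o m n o o<n = begin
  (m ℕ.* n ℕ.+ o) % n ≡⟨ cong (_% n) (ℕ.+-comm (m ℕ.* n) o) ⟩
  (o ℕ.+ m ℕ.* n) % n ≡⟨ [m+kn]%n≡m%n o m n ⟩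
  o % n               ≡⟨ m<n⇒m%n≡m o<n ⟩
  o                   ∎
  where open ≡-Reasoning

[m*n+o]/n≡m : ∀ m n o .{{_ : NonZero n}} → o ℕ.< n → (m ℕ.* n ℕ.+ o) / n ≡ m
[m*n+o]/n≡m m n o o<n = begin
  (m ℕ.* n ℕ.+ o) / n         ≡⟨ +-distrib-/ (m ℕ.* n) o remainders<n ⟩
  m ℕ.* n / n ℕ.+ o / n       ≡⟨ cong₂ ℕ._+_ (m*n/n≡m m n) (m<n⇒m/n≡0 o<n) ⟩
  m ℕ.+ 0                     ≡⟨ ℕ.+-identityʳ m ⟩
  m                           ∎
  where
  open ≡-Reasoning
  remainders<n : (m ℕ.* n) % n ℕ.+ o % n ℕ.< n
  remainders<n = subst (ℕ._< n) (sym (cong₂ ℕ._+_ (m*n%n≡0 m n) (m<n⇒m%n≡m o<n))) o<n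

cfExpand-1 : ∀ f q → cfExpand (suc f) 1 q ≡ [ q ]
cfExpand-1 f q with q % 1 | n%1≡0 q
... | .0 | refl = cong [_] (n/1≡n q)

cfExpand-step : ∀ f a p s → s ℕ.< p →
                cfExpand (suc f) (suc p) (a ℕ.* suc p ℕ.+ suc s) ≡ a ∷ cfExpand f (suc s) (suc p)
cfExpand-step f a p s s<p
  with (a ℕ.* suc p ℕ.+ suc s) % suc p | [m*n+o]%n≡o a (suc p) (suc s) (s≤s s<p)
... | .(suc s) | refl = cong (_∷ cfExpand f (suc s) (suc p)) ([m*n+o]/n≡m a (suc p) (suc s) (s≤s s<p))

cfExpand-convergent : ∀ {l} → Canonical l → ∀ f → numer l ℕ.≤ f →
                      cfExpand f (numer l) (denom l) ≡ l
cfExpand-convergent (end n) (suc f) _ =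
  trans (cfExpand-1 f _) (cong [_] (trans (ℕ.+-identityʳ _) (ℕ.*-identityʳ _)))
cfExpand-convergent {suc a ∷ l} (a ∷ can) f numer≤f
  with numer l | denom l | numer-nonZero can | denom-nonZero (Canonical⇒nonZero can)
     | numer<denom can | cfExpand-convergent can
... | suc s | suc p | _ | _ | s<p | ih with f | numer≤f
...   | suc f′ | s≤s p≤f′ = trans (cfExpand-step f′ (suc a) p s (ℕ.≤-pred s<p))
                                 (cong (suc a ∷_) (ih f′ (ℕ.≤-trans (ℕ.≤-pred s<p) p≤f′)))

cfExpand-canonical : ∀ f p q → 0 ℕ.< p → p ℕ.< q → Coprime p q → p ℕ.≤ f →
                     Canonical (cfExpand f p q) × convergent (cfExpand f p q) ≡ (p , q)
cfExpand-canonical (suc f) (suc p) q _ p<q coprime (s≤s p≤f) with q % suc p in q%p≡r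
... | zero with coprime (∣-refl , m%n≡0⇒n∣m q (suc p) q%p≡r)
...   | refl rewrite n/1≡n q =
  canonical-[ p<q ] , cong (1 ,_) (trans (ℕ.+-identityʳ _) (ℕ.*-identityʳ q))
cfExpand-canonical (suc f) (suc p) q _ p<q coprime (s≤s p≤f) | suc s =
  canonical-∷ (m≥n⇒m/n>0 (ℕ.<⇒≤ p<q)) (proj₁ ih) ,
  trans (cong (mobius (q / suc p)) (proj₂ ih)) (cong (suc p ,_) (trans (ℕ.+-comm _ (suc s)) (sym q≡)))
  where
  s<p : suc s ℕ.< suc p
  s<p = subst (ℕ._< suc p) q%p≡r (m%n<n q (suc p))
  q≡ : q ≡ suc s ℕ.+ q / suc p ℕ.* suc p
  q≡ = trans (m≡m%n+[m/n]*n q (suc p)) (cong (ℕ._+ q / suc p ℕ.* suc p) q%p≡r)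
  coprime′ : Coprime (suc s) (suc p)
  coprime′ (d∣s , d∣p) =
    coprime (d∣p , subst (_ ∣_) (sym q≡) (∣m∣n⇒∣m+n d∣s (∣n⇒∣m*n (q / suc p) d∣p)))
  ih : Canonical (cfExpand f (suc s) (suc p)) × convergent (cfExpand f (suc s) (suc p)) ≡ (suc s , suc p)
  ih = cfExpand-canonical f (suc s) (suc p) (s≤s z≤n) s<p coprime′
                          (ℕ.≤-trans (ℕ.≤-pred s<p) p≤f)

expansion-frac : ∀ a b .{{_ : NonZero b}} → Coprime a b → expansion (frac a b) ≡ cfExpand a a b
expansion-frac a (suc b) coprime = cong expansion (ℚ.normalize-coprime coprime)

expansion-cf : ∀ {l} → Canonical l → expansion (cf l) ≡ l
expansion-cf {l} can = begin
  expansion (cf l)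
    ≡⟨ cong expansion (cf-convergent (Canonical⇒nonZero can)) ⟩
  expansion (frac (numer l) (denom l))
    ≡⟨ expansion-frac (numer l) (denom l) {{denom≢0}} (numer-denom-coprime l) ⟩
  cfExpand (numer l) (numer l) (denom l)
    ≡⟨ cfExpand-convergent can (numer l) ℕ.≤-refl ⟩
  l ∎
  where
  open ≡-Reasoning
  denom≢0 : NonZero (denom l)
  denom≢0 = denom-nonZero (Canonical⇒nonZero can)

numerator<denominator : ∀ {n d} .{c : Coprime n (suc d)} → mkℚ (+ n) d c < 1ℚ → n ℕ.< suc d
numerator<denominator {n} {d} (ℚ.*<* n*1<1*d) =
  ℤ.drop‿+<+ (subst₂ ℤ._<_ (ℤ.*-identityʳ (+ n)) (ℤ.*-identityˡ (+ suc d)) n*1<1*d)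

cf-expansion : ∀ r → 0ℚ < r → r < 1ℚ → Canonical (expansion r) × cf (expansion r) ≡ r
cf-expansion (mkℚ (+ zero) d c) 0<r r<1 with 0-coprimeTo-m⇒m≡1 (recompute c)
... | refl = ⊥-elim (ℚ.<-irrefl refl 0<r)
cf-expansion r@(mkℚ -[1+ n ] d c) 0<r r<1 = ⊥-elim (ℚ.<-asym 0<r (ℚ.negative⁻¹ r))
cf-expansion r@(mkℚ (+ suc n) d coprime) 0<r r<1 = proj₁ expand , (begin
  cf (expansion r)                                  ≡⟨ cf-convergent (Canonical⇒nonZero (proj₁ expand)) ⟩
  frac (numer (expansion r)) (denom (expansion r))  ≡⟨ cong (uncurry frac) (proj₂ expand) ⟩
  frac (suc n) (suc d)                              ≡⟨ ℚ.normalize-coprime coprime ⟩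
  r                                                 ∎)
  where
  open ≡-Reasoning
  expand : Canonical (expansion r) × convergent (expansion r) ≡ (suc n , suc d)
  expand = cfExpand-canonical (suc n) (suc n) (suc d) (s≤s z≤n) (numerator<denominator r<1)
                              (recompute coprime) ℕ.≤-refl

-- Paths in the Farey tree

data Move : Set where
  inc new : Move

dual : Move → Move
dual inc = new
dual new = inc

-- The expansion of the vertex reached from ½ = [0, 2] along a path, its last entry already raised c times:
-- inc raises the last entry, new freezes it one lower and opens a new last entry 2.
expansionAt : ℕ → List Move → List ℕ
expansionAt c []        = [ 2 ℕ.+ c ]
expansionAt c (inc ∷ w) = expansionAt (suc c) w
expansionAt c (new ∷ w) = suc c ∷ expansionAt 0 w

vertex : List Move → ℚ
vertex w = cf (expansionAt 0 w)

pathTo : List ℕ → List Move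
pathTo []          = []
pathTo (n ∷ [])    = replicate (n ∸ 2) inc
pathTo (n ∷ m ∷ l) = replicate (n ∸ 1) inc ++ new ∷ pathTo (m ∷ l)

expansionAt-canonical : ∀ c w → Canonical (expansionAt c w)
expansionAt-canonical c []        = end c
expansionAt-canonical c (inc ∷ w) = expansionAt-canonical (suc c) w
expansionAt-canonical c (new ∷ w) = c ∷ expansionAt-canonical 0 w

expansionAt-nonempty : ∀ c w → ∃₂ λ n l → expansionAt c w ≡ n ∷ l
expansionAt-nonempty c []        = _ , _ , refl
expansionAt-nonempty c (inc ∷ w) = expansionAt-nonempty (suc c) w
expansionAt-nonempty c (new ∷ w) = _ , _ , refl

expansionAt-replicate : ∀ c k w → expansionAt c (replicate k inc ++ w) ≡ expansionAt (c ℕ.+ k) w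
expansionAt-replicate c zero    w = cong (λ n → expansionAt n w) (sym (ℕ.+-identityʳ c))
expansionAt-replicate c (suc k) w =
  trans (expansionAt-replicate (suc c) k w) (cong (λ n → expansionAt n w) (sym (ℕ.+-suc c k)))

expansionAt-pathTo : ∀ {l} → Canonical l → expansionAt 0 (pathTo l) ≡ l
expansionAt-pathTo (end n) =
  trans (cong (expansionAt 0) (sym (List.++-identityʳ (replicate n inc)))) (expansionAt-replicate 0 n [])
expansionAt-pathTo {suc a ∷ m ∷ l} (a ∷ can) =
  trans (expansionAt-replicate 0 a _) (cong (suc a ∷_) (expansionAt-pathTo can))

pathTo-expansionAt : ∀ c w → pathTo (expansionAt c w) ≡ replicate c inc ++ w
pathTo-expansionAt c []        = sym (List.++-identityʳ (replicate c inc))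
pathTo-expansionAt c (inc ∷ w) = trans (pathTo-expansionAt (suc c) w) (replicate-suc-++ c inc w)
pathTo-expansionAt c (new ∷ w) with expansionAt 0 w | pathTo-expansionAt 0 w | expansionAt-nonempty 0 w
... | .(n ∷ l) | ih | n , l , refl = cong (λ v → replicate c inc ++ new ∷ v) ih

expansion-vertex : ∀ w → expansion (vertex w) ≡ expansionAt 0 w
expansion-vertex w = expansion-cf (expansionAt-canonical 0 w)

vertex-injective : ∀ {v w} → vertex v ≡ vertex w → v ≡ w
vertex-injective {v} {w} eq = begin
  v                               ≡⟨ pathTo-expansionAt 0 v ⟨
  pathTo (expansionAt 0 v)        ≡⟨ cong pathTo (expansion-vertex v) ⟨
  pathTo (expansion (vertex v))   ≡⟨ cong (pathTo ∘ expansion) eq ⟩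
  pathTo (expansion (vertex w))   ≡⟨ cong pathTo (expansion-vertex w) ⟩
  pathTo (expansionAt 0 w)        ≡⟨ pathTo-expansionAt 0 w ⟩
  w                               ∎
  where open ≡-Reasoning

vertex-surjective : ∀ r → 0ℚ < r → r < 1ℚ → ∃ λ w → vertex w ≡ r
vertex-surjective r 0<r r<1 with cf-expansion r 0<r r<1
... | canonical , cf-expansion≡r =
  pathTo (expansion r) , trans (cong cf (expansionAt-pathTo canonical)) cf-expansion≡r

vertex-∷ʳ≢½ : ∀ w x → vertex (w ∷ʳ x) ≢ ½
vertex-∷ʳ≢½ []      x eq with () ← vertex-injective {[ x ]} {[]} eq
vertex-∷ʳ≢½ (y ∷ u) x eq with () ← vertex-injective {y ∷ u ∷ʳ x} {[]} eq

vertex≢1 : ∀ w → vertex w ≢ 1ℚ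
vertex≢1 w eq =
  Canonical⇒≢[1] (expansionAt-canonical 0 w) (trans (sym (expansion-vertex w)) (cong expansion eq))

-- Jimm along paths

-- expansionAt c w with its last entry c + 2 written as c + 1, 1: the form in which jimm produces it.
expansionAt′ : ℕ → List Move → List ℕ
expansionAt′ c []        = suc c ∷ 1 ∷ []
expansionAt′ c (inc ∷ w) = expansionAt′ (suc c) w
expansionAt′ c (new ∷ w) = suc c ∷ expansionAt′ 0 w

expansionAt′-nonZero : ∀ c w → All NonZero (expansionAt′ c w)
expansionAt′-nonZero c []        = _ ∷ _ ∷ []
expansionAt′-nonZero c (inc ∷ w) = expansionAt′-nonZero (suc c) w
expansionAt′-nonZero c (new ∷ w) = _ ∷ expansionAt′-nonZero 0 w

cf-expansionAt′ : ∀ c w → cf (expansionAt′ c w) ≡ cf (expansionAt c w)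
cf-expansionAt′ c w =
  cf-≡ (expansionAt′-nonZero c w) (Canonical⇒nonZero (expansionAt-canonical c w)) (same-convergent c w)
  where
  same-convergent : ∀ c w → convergent (expansionAt′ c w) ≡ convergent (expansionAt c w)
  same-convergent c []        = convergent-∷ʳ1 [] (suc c)
  same-convergent c (inc ∷ w) = same-convergent (suc c) w
  same-convergent c (new ∷ w) = cong (mobius (suc c)) (same-convergent 0 w)

expansionAt′-news : ∀ c n → expansionAt′ c (replicate n new) ≡ suc c ∷ replicate (suc n) 1
expansionAt′-news c zero    = refl
expansionAt′-news c (suc n) = cong (suc c ∷_) (expansionAt′-news 0 n)

expansionAt′-dual-incs : ∀ k w → expansionAt′ 0 (map dual (replicate k inc ++ w))
                                 ≡ replicate k 1 ++ expansionAt′ 0 (map dual w)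
expansionAt′-dual-incs zero    w = refl
expansionAt′-dual-incs (suc k) w = cong (1 ∷_) (expansionAt′-dual-incs k w)

reduce-ent : ∀ acc n ts → reduce acc false (ent n ∷ ts) ≡ reduce (n ∷ acc) false ts
reduce-ent []      n ts = refl
reduce-ent (_ ∷ _) n ts = refl

-- acc holds the output so far, reversed; its head suc c is the entry still open to merging.
reduce-jimmMid : ∀ {l} → Canonical l → ∀ c acc →
                 reduce (suc c ∷ acc) false (jimmMid l) ≡ reverse acc ++ expansionAt′ c (map dual (pathTo l))
reduce-jimmMid (end n) c acc = begin
  reverse (replicate (suc n) 1 ++ suc c ∷ acc)
    ≡⟨ reverse-replicate-++ (suc n) 1 (suc c) acc ⟩
  reverse acc ++ suc c ∷ replicate (suc n) 1
    ≡⟨ cong (reverse acc ++_) (expansionAt′-news c n) ⟨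
  reverse acc ++ expansionAt′ c (replicate n new)
    ≡⟨ cong (λ v → reverse acc ++ expansionAt′ c v) (List.map-replicate dual n inc) ⟨
  reverse acc ++ expansionAt′ c (map dual (replicate n inc)) ∎
  where open ≡-Reasoning
reduce-jimmMid {suc zero ∷ m ∷ l} (zero ∷ can) c acc =
  trans (cong (λ n → reduce (n ∷ acc) false (jimmMid (m ∷ l))) (ℕ.+-comm c 2))
        (reduce-jimmMid can (suc c) acc)
reduce-jimmMid {suc (suc a) ∷ m ∷ l} (suc a ∷ can) c acc = begin
  reduce (ones ++ suc c ∷ acc) false (ent 2 ∷ jimmMid (m ∷ l))
    ≡⟨ reduce-ent (ones ++ suc c ∷ acc) 2 _ ⟩
  reduce (2 ∷ ones ++ suc c ∷ acc) false (jimmMid (m ∷ l))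
    ≡⟨ reduce-jimmMid can 1 (ones ++ suc c ∷ acc) ⟩
  reverse (ones ++ suc c ∷ acc) ++ rest
    ≡⟨ cong (_++ rest) (reverse-replicate-++ a 1 (suc c) acc) ⟩
  (reverse acc ++ suc c ∷ ones) ++ rest
    ≡⟨ List.++-assoc (reverse acc) (suc c ∷ ones) rest ⟩
  reverse acc ++ suc c ∷ ones ++ rest
    ≡⟨ cong (λ v → reverse acc ++ suc c ∷ v) (expansionAt′-dual-incs a (new ∷ pathTo (m ∷ l))) ⟨
  reverse acc ++ expansionAt′ c (map dual (replicate (suc a) inc ++ new ∷ pathTo (m ∷ l))) ∎
  where
  open ≡-Reasoning
  ones : List ℕ
  ones = replicate a 1
  rest : List ℕ
  rest = expansionAt′ 1 (map dual (pathTo (m ∷ l)))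

jimmList-canonical : ∀ {l} → Canonical l → jimmList l ≡ expansionAt′ 0 (map dual (pathTo l))
jimmList-canonical (end n) =
  sym (trans (cong (expansionAt′ 0) (List.map-replicate dual n inc)) (expansionAt′-news 0 n))
jimmList-canonical {suc a ∷ m ∷ l} (a ∷ can) = begin
  reduce (ones ++ []) false (ent 2 ∷ jimmMid (m ∷ l))
    ≡⟨ reduce-ent (ones ++ []) 2 _ ⟩
  reduce (2 ∷ ones ++ []) false (jimmMid (m ∷ l))
    ≡⟨ reduce-jimmMid can 1 (ones ++ []) ⟩
  reverse (ones ++ []) ++ rest
    ≡⟨ cong (λ v → reverse v ++ rest) (List.++-identityʳ ones) ⟩
  reverse ones ++ rest
    ≡⟨ cong (_++ rest) (reverse-replicate a 1) ⟩
  ones ++ rest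
    ≡⟨ expansionAt′-dual-incs a (new ∷ pathTo (m ∷ l)) ⟨
  expansionAt′ 0 (map dual (replicate a inc ++ new ∷ pathTo (m ∷ l))) ∎
  where
  open ≡-Reasoning
  ones : List ℕ
  ones = replicate a 1
  rest : List ℕ
  rest = expansionAt′ 1 (map dual (pathTo (m ∷ l)))

J-≢1 : ∀ r → r ≢ 1ℚ → J r ≡ cf (jimmList (expansion r))
J-≢1 r r≢1 with r ℚ.≟ 1ℚ
... | yes r≡1 = ⊥-elim (r≢1 r≡1)
... | no _    = refl

J-vertex : ∀ w → J (vertex w) ≡ vertex (map dual w)
J-vertex w = begin
  J (vertex w)
    ≡⟨ J-≢1 (vertex w) (vertex≢1 w) ⟩
  cf (jimmList (expansion (vertex w)))
    ≡⟨ cong (cf ∘ jimmList) (expansion-vertex w) ⟩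
  cf (jimmList (expansionAt 0 w))
    ≡⟨ cong cf (jimmList-canonical (expansionAt-canonical 0 w)) ⟩
  cf (expansionAt′ 0 (map dual (pathTo (expansionAt 0 w))))
    ≡⟨ cong (λ v → cf (expansionAt′ 0 (map dual v))) (pathTo-expansionAt 0 w) ⟩
  cf (expansionAt′ 0 (map dual w))
    ≡⟨ cf-expansionAt′ 0 (map dual w) ⟩
  vertex (map dual w) ∎
  where open ≡-Reasoning

-- The transition function along paths

splitLast-∷ʳ : ∀ l n → splitLast (l ∷ʳ n) ≡ split l n
splitLast-∷ʳ []      n = refl
splitLast-∷ʳ (m ∷ l) n rewrite splitLast-∷ʳ l n = refl

fareyLength-∷ʳ : ∀ r ns n → expansion r ≡ ns ∷ʳ n →
                 fareyLength r ≡ ∣ cf ns - cf (ns ∷ʳ (n ∸ 1)) ∣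
fareyLength-∷ʳ r ns n eq with splitLast (expansion r) | trans (cong splitLast eq) (splitLast-∷ʳ ns n)
... | .(split ns n) | refl = refl

parent-∷ʳ : ∀ r ns n → expansion r ≡ ns ∷ʳ n → parent r ≡ cf (ns ∷ʳ (n ∸ 1))
parent-∷ʳ r ns n eq with splitLast (expansion r) | trans (cong splitLast eq) (splitLast-∷ʳ ns n)
... | .(split ns n) | refl = refl

πλ-≢½ : ∀ r → r ≢ ½ → πλ r ≡ fareyLength r ÷ℚ fareyLength (parent r)
πλ-≢½ r r≢½ with r ℚ.≟ ½
... | yes r≡½ = ⊥-elim (r≢½ r≡½)
... | no _    = refl

-- An expansion ns ∷ʳ 2 + k is recorded as (ns , k), so that walking down the tree acts on it by snoc.
splitStep : List ℕ × ℕ → Move → List ℕ × ℕ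
splitStep (ns , k) inc = ns , suc k
splitStep (ns , k) new = ns ∷ʳ suc k , 0

expansionSplit : List Move → List ℕ × ℕ
expansionSplit = foldl splitStep ([] , 0)

joinLast : List ℕ × ℕ → List ℕ
joinLast (ns , k) = ns ∷ʳ (2 ℕ.+ k)

parentExpansion : List ℕ × ℕ → List ℕ
parentExpansion (ns , k) = ns ∷ʳ suc k

expansionAt-foldl : ∀ w ns c → ns ++ expansionAt c w ≡ joinLast (foldl splitStep (ns , c) w)
expansionAt-foldl []        ns c = refl
expansionAt-foldl (inc ∷ w) ns c = expansionAt-foldl w ns (suc c)
expansionAt-foldl (new ∷ w) ns c =
  trans (sym (List.++-assoc ns [ suc c ] (expansionAt 0 w))) (expansionAt-foldl w (ns ∷ʳ suc c) 0)

expansion-vertex-split : ∀ w → expansion (vertex w) ≡ joinLast (expansionSplit w)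
expansion-vertex-split w = trans (expansion-vertex w) (expansionAt-foldl w [] 0)

joinLast-nonZero : ∀ w → All NonZero (joinLast (expansionSplit w))
joinLast-nonZero w =
  subst (All NonZero) (expansionAt-foldl w [] 0) (Canonical⇒nonZero (expansionAt-canonical 0 w))

-- Denominators of the endpoints [0, ns] and [0, ns, k + 1] of the Farey interval of [0, ns, k + 2].
intervalDenoms : List ℕ × ℕ → ℕ × ℕ
intervalDenoms (ns , k) = denom ns , denom (parentExpansion (ns , k))

denomProduct : ℕ × ℕ → ℕ
denomProduct (q , q′) = q ℕ.* q′

fareyStep : Move → ℕ × ℕ → ℕ × ℕ
fareyStep inc (q , q′) = q , q′ ℕ.+ q
fareyStep new (q , q′) = q′ , q ℕ.+ q′

intervalDenoms-splitStep : ∀ s x → intervalDenoms (splitStep s x) ≡ fareyStep x (intervalDenoms s)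
intervalDenoms-splitStep (ns , k) inc = cong (denom ns ,_) (cong proj₂ (convergent-∷ʳ-suc ns (suc k)))
intervalDenoms-splitStep (ns , k) new =
  cong (denom (ns ∷ʳ suc k) ,_) (cong proj₂ (convergent-∷ʳ-∷ʳ1 ns (suc k)))

fareyDenoms : List Move → ℕ × ℕ
fareyDenoms w = intervalDenoms (expansionSplit w)

fareyDenoms-∷ʳ : ∀ w x → fareyDenoms (w ∷ʳ x) ≡ fareyStep x (fareyDenoms w)
fareyDenoms-∷ʳ w x = trans (cong intervalDenoms (List.foldl-∷ʳ splitStep ([] , 0) x w))
                            (intervalDenoms-splitStep (expansionSplit w) x)

fareyDenoms-nonZero : ∀ w → NonZero (denomProduct (fareyDenoms w))
fareyDenoms-nonZero w = ℕ.m*n≢0 _ _ {{denom-nonZero ns≢0}} {{denom-nonZero (All.∷ʳ⁺ ns≢0 _)}}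
  where
  ns≢0 : All NonZero (proj₁ (expansionSplit w))
  ns≢0 = proj₁ (All.∷ʳ⁻ (joinLast-nonZero w))

fareyLength-vertex : ∀ w → fareyLength (vertex w) ≡ frac 1 (denomProduct (fareyDenoms w))
fareyLength-vertex w = trans (fareyLength-∷ʳ (vertex w) ns _ (expansion-vertex-split w))
                             (consecutive-convergents ns _ (All.∷ʳ⁺ ns≢0 _))
  where
  ns : List ℕ
  ns = proj₁ (expansionSplit w)
  ns≢0 : All NonZero ns
  ns≢0 = proj₁ (All.∷ʳ⁻ (joinLast-nonZero w))

cf-parentExpansion-splitStep : ∀ s x → All NonZero (joinLast s) →
                               cf (parentExpansion (splitStep s x)) ≡ cf (joinLast s)
cf-parentExpansion-splitStep (ns , k) inc _  = refl
cf-parentExpansion-splitStep (ns , k) new nz =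
  cf-≡ (All.∷ʳ⁺ (All.∷ʳ⁺ (proj₁ (All.∷ʳ⁻ nz)) _) _) nz (convergent-∷ʳ1 ns (suc k))

parent-vertex : ∀ w x → parent (vertex (w ∷ʳ x)) ≡ vertex w
parent-vertex w x = begin
  parent (vertex (w ∷ʳ x))
    ≡⟨ parent-∷ʳ (vertex (w ∷ʳ x)) _ _ (expansion-vertex-split (w ∷ʳ x)) ⟩
  cf (parentExpansion (expansionSplit (w ∷ʳ x)))
    ≡⟨ cong (cf ∘ parentExpansion) (List.foldl-∷ʳ splitStep ([] , 0) x w) ⟩
  cf (parentExpansion (splitStep s x))
    ≡⟨ cf-parentExpansion-splitStep s x (joinLast-nonZero w) ⟩
  cf (joinLast s)
    ≡⟨ cong cf (expansionAt-foldl w [] 0) ⟨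
  vertex w ∎
  where
  open ≡-Reasoning
  s : List ℕ × ℕ
  s = expansionSplit w

πλ-vertex-∷ʳ : ∀ w x → let d = fareyDenoms w in
               πλ (vertex (w ∷ʳ x)) ≡ frac (denomProduct d) (denomProduct (fareyStep x d))
πλ-vertex-∷ʳ w x = begin
  πλ (vertex (w ∷ʳ x))
    ≡⟨ πλ-≢½ _ (vertex-∷ʳ≢½ w x) ⟩
  fareyLength (vertex (w ∷ʳ x)) ÷ℚ fareyLength (parent (vertex (w ∷ʳ x)))
    ≡⟨ cong₂ _÷ℚ_ (fareyLength-vertex (w ∷ʳ x)) parent-length ⟩
  frac 1 (P (w ∷ʳ x)) ÷ℚ frac 1 (P w)
    ≡⟨ frac-÷ℚ _ _ {{fareyDenoms-nonZero (w ∷ʳ x)}} {{fareyDenoms-nonZero w}} ⟩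
  frac (P w) (P (w ∷ʳ x))
    ≡⟨ cong (frac (P w) ∘ denomProduct) (fareyDenoms-∷ʳ w x) ⟩
  frac (P w) (denomProduct (fareyStep x (fareyDenoms w))) ∎
  where
  open ≡-Reasoning
  P : List Move → ℕ
  P v = denomProduct (fareyDenoms v)
  parent-length : fareyLength (parent (vertex (w ∷ʳ x))) ≡ frac 1 (P w)
  parent-length = trans (cong fareyLength (parent-vertex w x)) (fareyLength-vertex w)

fareyDenoms-foldl : ∀ w → fareyDenoms w ≡ foldl (flip fareyStep) (1 , 1) w
fareyDenoms-foldl = foldl-fusion intervalDenoms ([] , 0) intervalDenoms-splitStep

convergent-expansionAt-suc : ∀ c v →
                             convergent (expansionAt (suc c) v) ≡ fareyStep inc (convergent (expansionAt c v))
convergent-expansionAt-suc c []        = cong (1 ,_) (lastEntry c)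
  where
  lastEntry : ∀ c → (3 ℕ.+ c) ℕ.* 1 ℕ.+ 0 ≡ (2 ℕ.+ c) ℕ.* 1 ℕ.+ 0 ℕ.+ 1
  lastEntry = solve-∀
convergent-expansionAt-suc c (inc ∷ v) = convergent-expansionAt-suc (suc c) v
convergent-expansionAt-suc c (new ∷ v) = cong (q ,_) (firstEntry c q p)
  where
  p q : ℕ
  p = numer (expansionAt 0 v)
  q = denom (expansionAt 0 v)
  firstEntry : ∀ c q p → (2 ℕ.+ c) ℕ.* q ℕ.+ p ≡ suc c ℕ.* q ℕ.+ p ℕ.+ q
  firstEntry = solve-∀

convergent-expansionAt-∷ : ∀ z v →
                           convergent (expansionAt 0 (z ∷ v)) ≡ fareyStep z (convergent (expansionAt 0 v))
convergent-expansionAt-∷ inc v = convergent-expansionAt-suc 0 v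
convergent-expansionAt-∷ new v = cong (q ,_) (trans (cong (ℕ._+ p) (ℕ.*-identityˡ q)) (ℕ.+-comm q p))
  where
  p q : ℕ
  p = numer (expansionAt 0 v)
  q = denom (expansionAt 0 v)

convergent-expansionAt : ∀ v → convergent (expansionAt 0 v) ≡ foldr fareyStep (1 , 2) v
convergent-expansionAt []      = refl
convergent-expansionAt (z ∷ v) =
  trans (convergent-expansionAt-∷ z v) (cong (fareyStep z) (convergent-expansionAt v))

fareyDenoms-∷ : ∀ y u → fareyDenoms (y ∷ u) ≡ convergent (expansionAt 0 (reverse u))
fareyDenoms-∷ y u = begin
  fareyDenoms (y ∷ u)                             ≡⟨ fareyDenoms-foldl (y ∷ u) ⟩
  foldl (flip fareyStep) (fareyStep y (1 , 1)) u  ≡⟨ cong (λ d → foldl (flip fareyStep) d u)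
                                                          (root-children y) ⟩
  foldl (flip fareyStep) (1 , 2) u                ≡⟨ List.reverse-foldr fareyStep (1 , 2) u ⟨
  foldr fareyStep (1 , 2) (reverse u)             ≡⟨ convergent-expansionAt (reverse u) ⟨
  convergent (expansionAt 0 (reverse u))          ∎
  where
  open ≡-Reasoning
  root-children : ∀ y → fareyStep y (1 , 1) ≡ (1 , 2)
  root-children inc = refl
  root-children new = refl

frac-fareyStep : ∀ x q q′ .{{_ : NonZero q}} .{{_ : NonZero q′}} →
                 frac (denomProduct (q , q′)) (denomProduct (fareyStep x (q , q′)))
                   ≡ uncurry frac (fareyStep (dual x) (q , q′))
frac-fareyStep inc q@(suc _) q′@(suc _) =
  frac-≡ (q ℕ.* q′) (q ℕ.* (q′ ℕ.+ q)) q′ (q ℕ.+ q′) (cross q q′)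
  where
  cross : ∀ q q′ → q ℕ.* q′ ℕ.* (q ℕ.+ q′) ≡ q′ ℕ.* (q ℕ.* (q′ ℕ.+ q))
  cross = solve-∀
frac-fareyStep new q@(suc _) q′@(suc _) =
  frac-≡ (q ℕ.* q′) (q′ ℕ.* (q ℕ.+ q′)) q (q′ ℕ.+ q) (cross q q′)
  where
  cross : ∀ q q′ → q ℕ.* q′ ℕ.* (q′ ℕ.+ q) ≡ q ℕ.* (q′ ℕ.* (q ℕ.+ q′))
  cross = solve-∀

πλ-vertex : ∀ y u x → πλ (vertex (y ∷ u ∷ʳ x)) ≡ vertex (dual x ∷ reverse u)
πλ-vertex y u x = begin
  πλ (vertex (y ∷ u ∷ʳ x))
    ≡⟨ πλ-vertex-∷ʳ (y ∷ u) x ⟩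
  frac (denomProduct d) (denomProduct (fareyStep x d))
    ≡⟨ cong (λ e → frac (denomProduct e) (denomProduct (fareyStep x e))) (fareyDenoms-∷ y u) ⟩
  frac (denomProduct (convergent v)) (denomProduct (fareyStep x (convergent v)))
    ≡⟨ frac-fareyStep x (numer v) (denom v) {{numer-nonZero can}} {{denom-nonZero (Canonical⇒nonZero can)}} ⟩
  uncurry frac (fareyStep (dual x) (convergent v))
    ≡⟨ cong (uncurry frac) (convergent-expansionAt-∷ (dual x) (reverse u)) ⟨
  uncurry frac (convergent (expansionAt 0 (dual x ∷ reverse u)))
    ≡⟨ cf-convergent (Canonical⇒nonZero (expansionAt-canonical 0 (dual x ∷ reverse u))) ⟨
  vertex (dual x ∷ reverse u) ∎
  where
  open ≡-Reasoning
  d : ℕ × ℕ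
  d = fareyDenoms (y ∷ u)
  v : List ℕ
  v = expansionAt 0 (reverse u)
  can : Canonical v
  can = expansionAt-canonical 0 (reverse u)

πλ-J-vertex : ∀ w → πλ (J (vertex w)) ≡ J (πλ (vertex w))
πλ-J-vertex w with reverseView w
... | []                 = refl
... | [] ∶ _ ∶ʳ inc       = refl
... | [] ∶ _ ∶ʳ new       = refl
... | (y ∷ u) ∶ _ ∶ʳ x    = begin
  πλ (J (vertex (y ∷ u ∷ʳ x)))
    ≡⟨ cong πλ (J-vertex (y ∷ u ∷ʳ x)) ⟩
  πλ (vertex (map dual (y ∷ u ∷ʳ x)))
    ≡⟨ cong (πλ ∘ vertex) (List.map-++ dual (y ∷ u) [ x ]) ⟩
  πλ (vertex (dual y ∷ map dual u ∷ʳ dual x))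
    ≡⟨ πλ-vertex (dual y) (map dual u) (dual x) ⟩
  vertex (dual (dual x) ∷ reverse (map dual u))
    ≡⟨ cong (vertex ∘ (dual (dual x) ∷_)) (List.reverse-map dual u) ⟨
  vertex (map dual (dual x ∷ reverse u))
    ≡⟨ J-vertex (dual x ∷ reverse u) ⟨
  J (vertex (dual x ∷ reverse u))
    ≡⟨ cong J (πλ-vertex y u x) ⟨
  J (πλ (vertex (y ∷ u ∷ʳ x))) ∎
  where open ≡-Reasoning

mainTheorem4 : (r : ℚ) → 0ℚ < r → r < 1ℚ → πλ (J r) ≡ J (πλ r)
mainTheorem4 r 0<r r<1 with vertex-surjective r 0<r r<1
... | w , refl = πλ-J-vertex w
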